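{- Let $\Delta$ be a positive integer and let $F$ be a forest whose vertex set is a subset of $[n]$, with $m$ connected components of sizes $\ell_1,\ldots,\ell_m\ge 1$, and $\ell=\ell_1+\ldots+\ell_m$. Let $T$ be a tree on $[n]$ with maximum degree at most $\Delta$ that contains $F$ as an induced subgraph. Then $m\le 1+(n-\ell)(\Delta-1)$.
   Context: A graph $T$ on $[n]$ contains $F$ as an induced subgraph if the subgraph of $T$ induced on $V(F)$ equals $F$. -}

module Defs where

open import Data.Nat using (ℕ; zero; suc; _+_; _≤_)
open import Data.Bool using (Bool; true; false)
open import Data.Fin using (Fin; zero; suc; inject₁; fromℕ)
open import Data.Fin.Subset using (Subset; _∈_)
open import Data.List using (List; length; filter; map)
open import Data.List using () renaming (allFin to allFinL)
open import Data.Product using (Σ; _×_; ∃; ∃-syntax; _,_)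
open import Data.Empty using (⊥)
open import Function using (_⇔_)
open import Function.Definitions using (Injective)
open import Relation.Binary.PropositionalEquality using (_≡_)
open import Relation.Binary.Construct.Closure.ReflexiveTransitive using (Star)
open import Relation.Nullary using (¬_)
open import Relation.Nullary.Decidable using (does)
open import Data.Bool.Properties using () renaming (_≟_ to _≟B_)

record Graph (n : ℕ) : Set where
  field
    adj   : Fin n → Fin n → Bool
    sym   : ∀ u v → adj u v ≡ adj v u
    loopless : ∀ u → adj u u ≡ false
open Graph public

Adj : ∀ {n} → Graph n → Fin n → Fin n → Set
Adj G u v = adj G u v ≡ true

Connected : ∀ {n} → Graph n → Fin n → Fin n → Set
Connected G = Star (Adj G)

degree : ∀ {n} → Graph n → Fin n → ℕ
degree {n} G u = length (filter (λ v → adj G u v ≟B true) (allFinL n))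

MaxDegreeAtMost : ∀ {n} → Graph n → ℕ → Set
MaxDegreeAtMost {n} G Δ = ∀ (u : Fin n) → degree G u ≤ Δ

Cycle : ∀ {n} → Graph n → Set
Cycle {n} G =
  Σ ℕ λ k → Σ (Fin (3 + k) → Fin n) λ f →
    Injective _≡_ _≡_ f
    × (∀ (i : Fin (2 + k)) → Adj G (f (inject₁ i)) (f (suc i)))
    × Adj G (f (fromℕ (2 + k))) (f zero)

Acyclic : ∀ {n} → Graph n → Set
Acyclic G = ¬ Cycle G

IsTree : ∀ {n} → Graph n → Set
IsTree {n} T = (∀ (u v : Fin n) → Connected T u v) × Acyclic T

IsForestOn : ∀ {n} → Subset n → Graph n → Set
IsForestOn {n} S F = (∀ (u v : Fin n) → Adj F u v → (u ∈ S) × (v ∈ S)) × Acyclic F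

InducedSubgraph : ∀ {n} → Subset n → Graph n → Graph n → Set
InducedSubgraph {n} S F T = ∀ (u v : Fin n) → u ∈ S → v ∈ S → adj F u v ≡ adj T u v

-- F (with vertex set S) has exactly m connected components: there is a labelling of
-- the vertices of S by Fin m, onto, with equal labels iff connected in F.
HasComponents : ∀ {n} → Subset n → Graph n → ℕ → Set
HasComponents {n} S F m =
  Σ ((v : Fin n) → v ∈ S → Fin m) λ c →
    (∀ (i : Fin m) → ∃[ v ] Σ (v ∈ S) λ p → c v p ≡ i)
    × (∀ (u v : Fin n) (p : u ∈ S) (q : v ∈ S) → (c u p ≡ c v q) ⇔ Connected F u v)

{-# OPTIONS --safe #-}

-- Root T at a vertex r of S and let every other vertex point to a neighbour closer to r
-- (breadth-first search).  In each component of F take a vertex closest to r, its top.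
-- A top x ≠ r has its parent outside S: otherwise the parent, adjacent to x in T = F on S,
-- would be a vertex of the same component closer to r.  Now code a top x ≠ r by the edge
-- parent x → x and an outside vertex u by the edge u → parent u, each edge being recorded
-- as (outside vertex, neighbour slot among its ≤ Δ neighbours).  Edges of the first kind go
-- away from r and edges of the second kind towards r, so with one extra code for r itself
-- the coding is injective, and m + (n − ℓ) ≤ 1 + (n − ℓ) Δ.

module Submission where

open import Defs
open import Data.Nat using (ℕ; _+_; _*_; _∸_; _≤_)
open import Data.Fin.Subset using (Subset; ∣_∣)

open import Data.Bool using (true; false)
open import Data.Bool.Properties using () renaming (_≟_ to _≟B_)
open import Data.Fin using (Fin; zero; suc; inject≤; combine; splitAt; _≟_)
open import Data.Fin.Properties
  using (any?; inject≤-injective; combine-injective; +↔⊎; injective⇒≤; suc-injective)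
open import Data.Fin.Subset using (∁; _∈_; _∉_)
open import Data.Fin.Subset.Properties using (_∈?_; x∉p⇒x∈∁p; x∈∁p⇒x∉p; ∣∁p∣≡n∸∣p∣)
open import Data.List using (List; filter; lookup) renaming (allFin to allFinL)
open import Data.List.Membership.Propositional using () renaming (_∈_ to _∈ₗ_)
open import Data.List.Membership.Propositional.Properties using (∈-filter⁺; ∈-allFin)
open import Data.List.Relation.Unary.Any using (index)
open import Data.List.Relation.Unary.Any.Properties using (lookup-index)
open import Data.Nat using (suc; zero; _<_; s≤s; z≤n) renaming (_≟_ to _≟ℕ_)
open import Data.Nat.Induction using (<-rec)
open import Data.Nat.Properties
  using (anyUpTo?; ≮⇒≥; <-asym; ≤⇒≯; ≤-trans; m≤m+n; *-suc; +-cancelʳ-≤; +-comm)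
open import Data.Product using (Σ; ∃-syntax; _×_; _,_; proj₁; proj₂)
open import Data.Sum using (_⊎_; inj₁; inj₂)
open import Data.Vec using (_∷_; here; there)
open import Function using (Injective; Injection; Equivalence; _∘_)
open import Function.Properties.Inverse using (Inverse⇒Injection)
open import Relation.Binary.PropositionalEquality
  using (_≡_; _≢_; refl; trans; cong; subst; subst₂; module ≡-Reasoning)
import Relation.Binary.PropositionalEquality as ≡
open import Relation.Binary.Construct.Closure.ReflexiveTransitive using (Star; ε; _◅_)
open import Relation.Nullary using (Dec; yes; no; contradiction)
open import Relation.Nullary.Decidable using (_×-dec_)
open import Relation.Unary using (Pred; Decidable)

module _ {p} {P : Pred ℕ p} (P? : Decidable P) where

  least-witness : ∀ {n} → P n → ∃[ k ] P k × (∀ {j} → P j → k ≤ j)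
  least-witness = <-rec _ step _
    where
    step : ∀ n → (∀ {j} → j < n → P j → ∃[ k ] P k × (∀ {i} → P i → k ≤ i)) →
           P n → ∃[ k ] P k × (∀ {j} → P j → k ≤ j)
    step n smaller pn with anyUpTo? P? n
    ... | yes (j , j<n , pj) = smaller j<n pj
    ... | no none = n , pn , λ pj → ≮⇒≥ λ j<n → none (_ , j<n , pj)

∈-irrelevant : ∀ {n} {x : Fin n} {p : Subset n} (q q′ : x ∈ p) → q ≡ q′
∈-irrelevant here      here       = refl
∈-irrelevant (there q) (there q′) = cong there (∈-irrelevant q q′)

enumerate : ∀ {n} (p : Subset n) → Fin ∣ p ∣ → Fin n
enumerate (true  ∷ p) zero    = zero
enumerate (true  ∷ p) (suc i) = suc (enumerate p i)
enumerate (false ∷ p) i       = suc (enumerate p i)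

position : ∀ {n} {x : Fin n} {p : Subset n} → x ∈ p → Fin ∣ p ∣
position {p = true  ∷ p} here      = zero
position {p = true  ∷ p} (there q) = suc (position q)
position {p = false ∷ p} (there q) = position q

enumerate-position : ∀ {n} {x : Fin n} {p : Subset n} (q : x ∈ p) → enumerate p (position q) ≡ x
enumerate-position {p = true  ∷ p} here      = refl
enumerate-position {p = true  ∷ p} (there q) = cong suc (enumerate-position q)
enumerate-position {p = false ∷ p} (there q) = cong suc (enumerate-position q)

enumerate-∈ : ∀ {n} (p : Subset n) i → enumerate p i ∈ p
enumerate-∈ (true  ∷ p) zero    = here
enumerate-∈ (true  ∷ p) (suc i) = there (enumerate-∈ p i)
enumerate-∈ (false ∷ p) i       = there (enumerate-∈ p i)

position-enumerate : ∀ {n} (p : Subset n) i → position (enumerate-∈ p i) ≡ i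
position-enumerate (true  ∷ p) zero    = refl
position-enumerate (true  ∷ p) (suc i) = cong suc (position-enumerate p i)
position-enumerate (false ∷ p) i       = position-enumerate p i

position-cong : ∀ {n} {x y : Fin n} {p : Subset n} → x ≡ y → (q : x ∈ p) (q′ : y ∈ p) →
                position q ≡ position q′
position-cong refl q q′ = cong position (∈-irrelevant q q′)

position-injective : ∀ {n} {x y : Fin n} {p : Subset n} (q : x ∈ p) (q′ : y ∈ p) →
                     position q ≡ position q′ → x ≡ y
position-injective q q′ eq =
  trans (≡.sym (enumerate-position q)) (trans (cong (enumerate _) eq) (enumerate-position q′))

enumerate-injective : ∀ {n} (p : Subset n) → Injective _≡_ _≡_ (enumerate p)
enumerate-injective p {i} {j} eq =
  trans (≡.sym (position-enumerate p i))
        (trans (position-cong eq (enumerate-∈ p i) (enumerate-∈ p j)) (position-enumerate p j))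

module _ {n} (G : Graph n) where

  neighbours : Fin n → List (Fin n)
  neighbours u = filter (λ v → adj G u v ≟B true) (allFinL n)

  ∈-neighbours : ∀ {u v} → Adj G u v → v ∈ₗ neighbours u
  ∈-neighbours {u} e = ∈-filter⁺ (λ v → adj G u v ≟B true) (∈-allFin _) e

  neighbourIndex : ∀ {Δ u v} → degree G u ≤ Δ → Adj G u v → Fin Δ
  neighbourIndex bound e = inject≤ (index (∈-neighbours e)) bound

  neighbourIndex-injective : ∀ {Δ u v w} (bound : degree G u ≤ Δ) (e : Adj G u v) (e′ : Adj G u w) →
                             neighbourIndex bound e ≡ neighbourIndex bound e′ → v ≡ w
  neighbourIndex-injective {u = u} {v} {w} bound e e′ eq = begin
    v                                               ≡⟨ lookup-index (∈-neighbours e) ⟩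
    lookup (neighbours u) (index (∈-neighbours e))  ≡⟨ cong (lookup (neighbours u)) same-index ⟩
    lookup (neighbours u) (index (∈-neighbours e′)) ≡⟨ ≡.sym (lookup-index (∈-neighbours e′)) ⟩
    w                                               ∎
    where
    open ≡-Reasoning
    same-index : index (∈-neighbours e) ≡ index (∈-neighbours e′)
    same-index = inject≤-injective bound bound _ _ eq

record RootedSpanningTree {n} (G : Graph n) (r : Fin n) : Set where
  field
    depth        : Fin n → ℕ
    parent       : Fin n → Fin n
    parent-adj   : ∀ {x} → x ≢ r → Adj G x (parent x)
    parent-depth : ∀ {x} → x ≢ r → depth (parent x) < depth x

module BreadthFirst {n} (G : Graph n) (r : Fin n) where

  WalkToRoot : ℕ → Fin n → Set
  WalkToRoot zero    x = x ≡ r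
  WalkToRoot (suc k) x = ∃[ y ] Adj G x y × WalkToRoot k y

  walkToRoot? : ∀ k x → Dec (WalkToRoot k x)
  walkToRoot? zero    x = x ≟ r
  walkToRoot? (suc k) x = any? λ y → (adj G x y ≟B true) ×-dec walkToRoot? k y

  walkLength : ∀ {x} → Star (Adj G) x r → ∃[ k ] WalkToRoot k x
  walkLength ε       = 0 , refl
  walkLength (e ◅ w) = let k , w′ = walkLength w in suc k , _ , e , w′

  module _ (connected : ∀ u v → Connected G u v) where

    shortest : ∀ x → ∃[ k ] WalkToRoot k x × (∀ {j} → WalkToRoot j x → k ≤ j)
    shortest x = least-witness (λ k → walkToRoot? k x) (proj₂ (walkLength (connected x r)))

    distance : Fin n → ℕ
    distance x = proj₁ (shortest x)

    distance-minimal : ∀ {k x} → WalkToRoot k x → distance x ≤ k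
    distance-minimal {x = x} = proj₂ (proj₂ (shortest x))

    closer : ∀ {k x} → WalkToRoot k x → x ≢ r → ∃[ y ] Adj G x y × distance y < k
    closer {zero}  x≡r       x≢r = contradiction x≡r x≢r
    closer {suc k} (y , e , w) _ = y , e , s≤s (distance-minimal w)

    towardsRoot : ∀ {x} → x ≢ r → ∃[ y ] Adj G x y × distance y < distance x
    towardsRoot {x} = closer (proj₁ (proj₂ (shortest x)))

    parent : Fin n → Fin n
    parent x with x ≟ r
    ... | yes _   = r
    ... | no  x≢r = proj₁ (towardsRoot x≢r)

    parent-spec : ∀ {x} → x ≢ r → Adj G x (parent x) × distance (parent x) < distance x
    parent-spec {x} x≢r with x ≟ r
    ... | yes x≡r  = contradiction x≡r x≢r
    ... | no  x≢r′ = proj₂ (towardsRoot x≢r′)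

    spanningTree : RootedSpanningTree G r
    spanningTree = record
      { depth        = distance
      ; parent       = parent
      ; parent-adj   = λ x≢r → proj₁ (parent-spec x≢r)
      ; parent-depth = λ x≢r → proj₂ (parent-spec x≢r)
      }

Entry : ∀ {n} {G : Graph n} {r : Fin n} → RootedSpanningTree G r → Subset n → Fin n → Set
Entry {r = r} τ S x = x ≢ r → RootedSpanningTree.parent τ x ∉ S

module Entries {n Δ} {G : Graph n} {r : Fin n}
  (maxDegree : MaxDegreeAtMost G Δ) (τ : RootedSpanningTree G r) (S : Subset n) (r∈S : r ∈ S) where

  open RootedSpanningTree τ

  private
    k : ℕ
    k = ∣ ∁ S ∣

    outsider : Fin k → Fin n
    outsider = enumerate (∁ S)

    outsider-∉ : ∀ j → outsider j ∉ S
    outsider-∉ j = x∈∁p⇒x∉p (enumerate-∈ (∁ S) j)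

    outsider≢r : ∀ j → outsider j ≢ r
    outsider≢r j refl = outsider-∉ j r∈S

    child-adj : ∀ {x} → x ≢ r → Adj G (parent x) x
    child-adj {x} x≢r = trans (Graph.sym G (parent x) x) (parent-adj x≢r)

  edgeCode : ∀ {u v} → u ∉ S → Adj G u v → Fin (k * Δ)
  edgeCode {u} u∉S e = combine (position (x∉p⇒x∈∁p u∉S)) (neighbourIndex G (maxDegree u) e)

  edgeCode-injective : ∀ {u u′ v v′} (u∉S : u ∉ S) (u′∉S : u′ ∉ S)
                       (e : Adj G u v) (e′ : Adj G u′ v′) →
                       edgeCode u∉S e ≡ edgeCode u′∉S e′ → u ≡ u′ × v ≡ v′
  edgeCode-injective u∉S u′∉S e e′ eq with combine-injective _ _ _ _ eq
  ... | same-position , same-index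
      with position-injective (x∉p⇒x∈∁p u∉S) (x∉p⇒x∈∁p u′∉S) same-position
  ... | refl = refl , neighbourIndex-injective G (maxDegree _) e e′ same-index

  module _ {m} (entry : Fin m → Fin n) (entry-injective : Injective _≡_ _≡_ entry)
           (isEntry : ∀ i → Entry τ S (entry i)) where

    entryCode : ∀ i → Dec (entry i ≡ r) → Fin (suc (k * Δ))
    entryCode i (yes _)   = zero
    entryCode i (no  x≢r) = suc (edgeCode (isEntry i x≢r) (child-adj x≢r))

    outsiderCode : Fin k → Fin (suc (k * Δ))
    outsiderCode j = suc (edgeCode (outsider-∉ j) (parent-adj (outsider≢r j)))

    code : Fin m ⊎ Fin k → Fin (suc (k * Δ))
    code (inj₁ i) = entryCode i (entry i ≟ r)
    code (inj₂ j) = outsiderCode j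

    entryCode-injective : ∀ i i′ d d′ → entryCode i d ≡ entryCode i′ d′ → i ≡ i′
    entryCode-injective i i′ (yes x≡r) (yes x′≡r) eq = entry-injective (trans x≡r (≡.sym x′≡r))
    entryCode-injective i i′ (yes _)   (no  _)    ()
    entryCode-injective i i′ (no  _)   (yes _)    ()
    entryCode-injective i i′ (no  x≢r) (no  x′≢r) eq =
      entry-injective (proj₂ (edgeCode-injective _ _ _ _ (suc-injective eq)))

    entryCode≢outsiderCode : ∀ i j d → entryCode i d ≢ outsiderCode j
    entryCode≢outsiderCode i j (yes _)  ()
    entryCode≢outsiderCode i j (no x≢r) eq with edgeCode-injective _ _ _ _ (suc-injective eq)
    ... | parent≡u , x≡parent-u =
      <-asym (parent-depth x≢r)
             (subst₂ (λ a b → depth a < depth b) (≡.sym x≡parent-u) (≡.sym parent≡u)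
                     (parent-depth (outsider≢r j)))

    code-injective : Injective _≡_ _≡_ code
    code-injective {inj₁ i} {inj₁ i′} eq = cong inj₁ (entryCode-injective i i′ _ _ eq)
    code-injective {inj₁ i} {inj₂ j}  eq = contradiction eq (entryCode≢outsiderCode i j _)
    code-injective {inj₂ j} {inj₁ i}  eq = contradiction (≡.sym eq) (entryCode≢outsiderCode i j _)
    code-injective {inj₂ j} {inj₂ j′} eq =
      cong inj₂ (enumerate-injective (∁ S) (proj₁ (edgeCode-injective _ _ _ _ (suc-injective eq))))

    entries-bound : m + k ≤ suc (k * Δ)
    entries-bound = injective⇒≤ {f = code ∘ splitAt m}
      (Injection.injective (Inverse⇒Injection (+↔⊎ {m} {k})) ∘ code-injective)

module Components {n m} {S : Subset n} {F G : Graph n} (components : HasComponents S F m)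
  (induced : InducedSubgraph S F G) {r : Fin n} (τ : RootedSpanningTree G r) where

  open RootedSpanningTree τ

  private
    label : ∀ v → v ∈ S → Fin m
    label = proj₁ components

    label-onto : ∀ i → ∃[ v ] Σ (v ∈ S) λ q → label v q ≡ i
    label-onto = proj₁ (proj₂ components)

    label-connected : ∀ u v (q : u ∈ S) (q′ : v ∈ S) → Connected F u v → label u q ≡ label v q′
    label-connected u v q q′ = Equivalence.from (proj₂ (proj₂ components) u v q q′)

  label-cong : ∀ {u v} → u ≡ v → (q : u ∈ S) (q′ : v ∈ S) → label u q ≡ label v q′
  label-cong refl q q′ = cong (label _) (∈-irrelevant q q′)

  label-adj : ∀ {u v} (q : u ∈ S) (q′ : v ∈ S) → Adj G u v → label u q ≡ label v q′
  label-adj q q′ e = label-connected _ _ q q′ (trans (induced _ _ q q′) e ◅ ε)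

  InComponent : Fin m → Fin n → Set
  InComponent i v = Σ (v ∈ S) λ q → label v q ≡ i

  inComponent? : ∀ i v → Dec (InComponent i v)
  inComponent? i v with v ∈? S
  ... | no  v∉S = no (v∉S ∘ proj₁)
  ... | yes q with label v q ≟ i
  ...   | yes eq  = yes (q , eq)
  ...   | no  neq = no λ (q′ , eq) → neq (trans (label-cong refl q q′) eq)

  AtDepth : Fin m → ℕ → Set
  AtDepth i d = ∃[ v ] InComponent i v × depth v ≡ d

  topDepth : ∀ i → ∃[ d ] AtDepth i d × (∀ {d′} → AtDepth i d′ → d ≤ d′)
  topDepth i =
    least-witness (λ d → any? λ v → inComponent? i v ×-dec (depth v ≟ℕ d))
                  (let v , inc = label-onto i in v , inc , refl)

  top : Fin m → Fin n
  top i = let _ , (v , _) , _ = topDepth i in v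

  top-in : ∀ i → InComponent i (top i)
  top-in i = let _ , (_ , inc , _) , _ = topDepth i in inc

  top-shallowest : ∀ {i v} → InComponent i v → depth (top i) ≤ depth v
  top-shallowest {i} {v} inc =
    let _ , (_ , _ , depth≡d) , least = topDepth i in
    subst (_≤ depth v) (≡.sym depth≡d) (least (v , inc , refl))

  top-injective : Injective _≡_ _≡_ top
  top-injective {i} {j} eq =
    let q , label≡i = top-in i ; q′ , label≡j = top-in j in
    trans (≡.sym label≡i) (trans (label-cong eq q q′) label≡j)

  top-entry : ∀ i → Entry τ S (top i)
  top-entry i x≢r parent∈S =
    let q , label≡i = top-in i in
    ≤⇒≯ (top-shallowest (parent∈S , trans (≡.sym (label-adj q parent∈S (parent-adj x≢r))) label≡i))
        (parent-depth x≢r)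

m+k≤1+k*Δ⇒m≤1+k*[Δ∸1] : ∀ m k Δ → m + k ≤ suc (k * Δ) → m ≤ suc (k * (Δ ∸ 1))
m+k≤1+k*Δ⇒m≤1+k*[Δ∸1] m k zero     le = ≤-trans (m≤m+n m k) le
m+k≤1+k*Δ⇒m≤1+k*[Δ∸1] m k (suc δ) le = +-cancelʳ-≤ k m (suc (k * δ))
  (subst (m + k ≤_) (cong suc (trans (*-suc k δ) (+-comm k (k * δ)))) le)

claim3 : (n Δ m : ℕ) (S : Subset n) (F T : Graph n) →
    1 ≤ Δ →
    IsForestOn S F →
    HasComponents S F m →
    IsTree T →
    MaxDegreeAtMost T Δ →
    InducedSubgraph S F T →
    m ≤ 1 + (n ∸ ∣ S ∣) * (Δ ∸ 1)
claim3 n Δ zero    S F T _ _ _          _               _         _       = z≤n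
claim3 n Δ (suc m) S F T _ _ components@(_ , onto , _) (connected , _) maxDegree induced
  with onto zero
... | r , r∈S , _ =
  subst (λ k → suc m ≤ 1 + k * (Δ ∸ 1)) (∣∁p∣≡n∸∣p∣ S)
    (m+k≤1+k*Δ⇒m≤1+k*[Δ∸1] (suc m) ∣ ∁ S ∣ Δ
      (Entries.entries-bound maxDegree τ S r∈S top top-injective top-entry))
  where
  τ : RootedSpanningTree T r
  τ = BreadthFirst.spanningTree T r connected
  open Components {F = F} components induced τ
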